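{- (1) $\mathsf{LKur}\subsetneq\mathsf{GKur}$. (2) $\mathsf{MGrz}\vee\mathsf{LKur}=\mathsf{MGrz}\vee\mathsf{GKur}$.
   Context: $\mathcal{L}_{\forall\exists}$ is the intuitionistic propositional language with modalities $\forall,\exists$; $\mathsf{MIPC}$ is the smallest set of $\mathcal{L}_{\forall\exists}$-formulas containing all intuitionistic propositional theorems, $\forall(p\wedge q)\leftrightarrow(\forall p\wedge\forall q)$, $\forall p\to p$, $\forall p\to\forall\forall p$, $\exists(p\vee q)\leftrightarrow(\exists p\vee\exists q)$, $p\to\exists p$, $\exists\exists p\to\exists p$, $(\exists p\wedge\exists q)\to\exists(\exists p\wedge q)$, $\exists\forall p\to\forall p$, $\exists p\to\forall\exists p$, closed under modus ponens, substitution and $\varphi/\forall\varphi$; $\mathsf{Kur}$ is the smallest such set also containing $\forall\neg\neg p\to\neg\neg\forall p$. $\mathcal{L}_{\Box\forall}$ is the classical propositional language with modalities $\Box,\forall$; $\Diamond=\neg\Box\neg$, $\exists=\neg\forall\neg$. $\mathsf{MS4}$ is the smallest set of $\mathcal{L}_{\Box\forall}$-formulas containing classical tautologies, $\mathsf{S4}$ axioms for $\Box$, $\mathsf{S5}$ axioms for $\forall$, and $\Box\forall p\to\forall\Box p$, closed under modus ponens, substitution, and necessitation for $\Box$ and $\forall$; extensions are such sets containing $\mathsf{MS4}$; $\mathsf{MS4}+\Gamma$ is the least extension containing $\Gamma$ and $\mathsf{M}_1\vee\mathsf{M}_2$ the least extension containing both. $\mathsf{MGrz}=\mathsf{MS4}+(\Box(\Box(p\to\Box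 p)\to p)\to p)$, $\mathsf{LKur}=\mathsf{MS4}+(\Box\forall\Diamond\Box p\to\Diamond\forall p)$. The Gödel translation: $\bot^t=\bot$, $p^t=\Box p$, $(\varphi\wedge\psi)^t=\varphi^t\wedge\psi^t$, $(\varphi\vee\psi)^t=\varphi^t\vee\psi^t$, $(\varphi\to\psi)^t=\Box(\neg\varphi^t\vee\psi^t)$, $(\forall\varphi)^t=\Box\forall\varphi^t$, $(\exists\varphi)^t=\exists\varphi^t$. $\mathsf{GKur}=\mathsf{MS4}+\{\varphi^t:\mathsf{Kur}\vdash\varphi\}$. -}

module Defs where

open import Data.Nat using (ℕ)
open import Data.Product using (_×_)
open import Data.Sum using (_⊎_)
open import Data.Empty using (⊥)
open import Relation.Nullary using (¬_)

data IFm : Set where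
  var  : ℕ → IFm
  ⊥ᵢ   : IFm
  _∧ᵢ_ : IFm → IFm → IFm
  _∨ᵢ_ : IFm → IFm → IFm
  _⇒ᵢ_ : IFm → IFm → IFm
  ∀ᵢ   : IFm → IFm
  ∃ᵢ   : IFm → IFm

infixr 6 _∧ᵢ_
infixr 5 _∨ᵢ_
infixr 4 _⇒ᵢ_

¬ᵢ_ : IFm → IFm
¬ᵢ a = a ⇒ᵢ ⊥ᵢ

_⇔ᵢ_ : IFm → IFm → IFm
a ⇔ᵢ b = (a ⇒ᵢ b) ∧ᵢ (b ⇒ᵢ a)

isubst : (ℕ → IFm) → IFm → IFm
isubst σ (var n)  = σ n
isubst σ ⊥ᵢ       = ⊥ᵢ
isubst σ (a ∧ᵢ b) = isubst σ a ∧ᵢ isubst σ b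
isubst σ (a ∨ᵢ b) = isubst σ a ∨ᵢ isubst σ b
isubst σ (a ⇒ᵢ b) = isubst σ a ⇒ᵢ isubst σ b
isubst σ (∀ᵢ a)   = ∀ᵢ (isubst σ a)
isubst σ (∃ᵢ a)   = ∃ᵢ (isubst σ a)

-- Hilbert axiom schemes of intuitionistic propositional logic
-- (instantiated with arbitrary L_{∀∃}-formulas); together with modus
-- ponens they generate exactly the substitution instances of IPC theorems.
data IPCAx : IFm → Set where
  ax-K   : ∀ a b → IPCAx (a ⇒ᵢ b ⇒ᵢ a)
  ax-S   : ∀ a b c → IPCAx ((a ⇒ᵢ b ⇒ᵢ c) ⇒ᵢ (a ⇒ᵢ b) ⇒ᵢ a ⇒ᵢ c)
  ax-∧I  : ∀ a b → IPCAx (a ⇒ᵢ b ⇒ᵢ a ∧ᵢ b)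
  ax-∧E₁ : ∀ a b → IPCAx (a ∧ᵢ b ⇒ᵢ a)
  ax-∧E₂ : ∀ a b → IPCAx (a ∧ᵢ b ⇒ᵢ b)
  ax-∨I₁ : ∀ a b → IPCAx (a ⇒ᵢ a ∨ᵢ b)
  ax-∨I₂ : ∀ a b → IPCAx (b ⇒ᵢ a ∨ᵢ b)
  ax-∨E  : ∀ a b c → IPCAx ((a ⇒ᵢ c) ⇒ᵢ (b ⇒ᵢ c) ⇒ᵢ a ∨ᵢ b ⇒ᵢ c)
  ax-⊥E  : ∀ a → IPCAx (⊥ᵢ ⇒ᵢ a)

pᵢ qᵢ : IFm
pᵢ = var 0
qᵢ = var 1

data MIPCAx : IFm → Set where
  a1 : MIPCAx (∀ᵢ (pᵢ ∧ᵢ qᵢ) ⇔ᵢ (∀ᵢ pᵢ ∧ᵢ ∀ᵢ qᵢ))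
  a2 : MIPCAx (∀ᵢ pᵢ ⇒ᵢ pᵢ)
  a3 : MIPCAx (∀ᵢ pᵢ ⇒ᵢ ∀ᵢ (∀ᵢ pᵢ))
  a4 : MIPCAx (∃ᵢ (pᵢ ∨ᵢ qᵢ) ⇔ᵢ (∃ᵢ pᵢ ∨ᵢ ∃ᵢ qᵢ))
  a5 : MIPCAx (pᵢ ⇒ᵢ ∃ᵢ pᵢ)
  a6 : MIPCAx (∃ᵢ (∃ᵢ pᵢ) ⇒ᵢ ∃ᵢ pᵢ)
  a7 : MIPCAx ((∃ᵢ pᵢ ∧ᵢ ∃ᵢ qᵢ) ⇒ᵢ ∃ᵢ (∃ᵢ pᵢ ∧ᵢ qᵢ))
  a8 : MIPCAx (∃ᵢ (∀ᵢ pᵢ) ⇒ᵢ ∀ᵢ pᵢ)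
  a9 : MIPCAx (∃ᵢ pᵢ ⇒ᵢ ∀ᵢ (∃ᵢ pᵢ))

data MIPC+_⊢_ (Γ : IFm → Set) : IFm → Set where
  ipc   : ∀ {a} → IPCAx a → MIPC+ Γ ⊢ a
  mipc  : ∀ {a} → MIPCAx a → MIPC+ Γ ⊢ a
  extra : ∀ {a} → Γ a → MIPC+ Γ ⊢ a
  mp    : ∀ {a b} → MIPC+ Γ ⊢ (a ⇒ᵢ b) → MIPC+ Γ ⊢ a → MIPC+ Γ ⊢ b
  sub   : ∀ {a} (σ : ℕ → IFm) → MIPC+ Γ ⊢ a → MIPC+ Γ ⊢ isubst σ a
  gen   : ∀ {a} → MIPC+ Γ ⊢ a → MIPC+ Γ ⊢ ∀ᵢ a

data KurAx : IFm → Set where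
  kur : KurAx (∀ᵢ (¬ᵢ ¬ᵢ pᵢ) ⇒ᵢ ¬ᵢ ¬ᵢ (∀ᵢ pᵢ))

Kur : IFm → Set
Kur a = MIPC+ KurAx ⊢ a

data Fm : Set where
  var  : ℕ → Fm
  ⊥'   : Fm
  _∧'_ : Fm → Fm → Fm
  _∨'_ : Fm → Fm → Fm
  _⇒_  : Fm → Fm → Fm
  □    : Fm → Fm
  ∀'   : Fm → Fm

infixr 6 _∧'_
infixr 5 _∨'_
infixr 4 _⇒_

¬'_ : Fm → Fm
¬' a = a ⇒ ⊥'

◇ : Fm → Fm
◇ a = ¬' □ (¬' a)

∃' : Fm → Fm
∃' a = ¬' ∀' (¬' a)

subst : (ℕ → Fm) → Fm → Fm
subst σ (var n)  = σ n
subst σ ⊥'       = ⊥'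
subst σ (a ∧' b) = subst σ a ∧' subst σ b
subst σ (a ∨' b) = subst σ a ∨' subst σ b
subst σ (a ⇒ b)  = subst σ a ⇒ subst σ b
subst σ (□ a)    = □ (subst σ a)
subst σ (∀' a)   = ∀' (subst σ a)

-- Hilbert axiom schemes of classical propositional logic; with modus
-- ponens they generate exactly the classical tautologies (instances).
data CPCAx : Fm → Set where
  ax-K   : ∀ a b → CPCAx (a ⇒ b ⇒ a)
  ax-S   : ∀ a b c → CPCAx ((a ⇒ b ⇒ c) ⇒ (a ⇒ b) ⇒ a ⇒ c)
  ax-∧I  : ∀ a b → CPCAx (a ⇒ b ⇒ a ∧' b)
  ax-∧E₁ : ∀ a b → CPCAx (a ∧' b ⇒ a)
  ax-∧E₂ : ∀ a b → CPCAx (a ∧' b ⇒ b)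
  ax-∨I₁ : ∀ a b → CPCAx (a ⇒ a ∨' b)
  ax-∨I₂ : ∀ a b → CPCAx (b ⇒ a ∨' b)
  ax-∨E  : ∀ a b c → CPCAx ((a ⇒ c) ⇒ (b ⇒ c) ⇒ a ∨' b ⇒ c)
  ax-⊥E  : ∀ a → CPCAx (⊥' ⇒ a)
  ax-DN  : ∀ a → CPCAx (¬' ¬' a ⇒ a)

p q : Fm
p = var 0
q = var 1

data MS4Ax : Fm → Set where
  □K  : MS4Ax (□ (p ⇒ q) ⇒ □ p ⇒ □ q)
  □T  : MS4Ax (□ p ⇒ p)
  □4  : MS4Ax (□ p ⇒ □ (□ p))
  ∀K  : MS4Ax (∀' (p ⇒ q) ⇒ ∀' p ⇒ ∀' q)
  ∀T  : MS4Ax (∀' p ⇒ p)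
  ∀5  : MS4Ax (∃' p ⇒ ∀' (∃' p))
  com : MS4Ax (□ (∀' p) ⇒ ∀' (□ p))

data MS4+_⊢_ (Γ : Fm → Set) : Fm → Set where
  cpc   : ∀ {a} → CPCAx a → MS4+ Γ ⊢ a
  ms4   : ∀ {a} → MS4Ax a → MS4+ Γ ⊢ a
  extra : ∀ {a} → Γ a → MS4+ Γ ⊢ a
  mp    : ∀ {a b} → MS4+ Γ ⊢ (a ⇒ b) → MS4+ Γ ⊢ a → MS4+ Γ ⊢ b
  sub   : ∀ {a} (σ : ℕ → Fm) → MS4+ Γ ⊢ a → MS4+ Γ ⊢ subst σ a
  nec□  : ∀ {a} → MS4+ Γ ⊢ a → MS4+ Γ ⊢ □ a
  nec∀  : ∀ {a} → MS4+ Γ ⊢ a → MS4+ Γ ⊢ ∀' a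

Logic : Set₁
Logic = Fm → Set

_∨L_ : Logic → Logic → Logic
(M₁ ∨L M₂) a = MS4+ (λ b → M₁ b ⊎ M₂ b) ⊢ a

_⊆L_ : Logic → Logic → Set
M₁ ⊆L M₂ = ∀ a → M₁ a → M₂ a

_≐L_ : Logic → Logic → Set
M₁ ≐L M₂ = (M₁ ⊆L M₂) × (M₂ ⊆L M₁)

_⊊L_ : Logic → Logic → Set
M₁ ⊊L M₂ = (M₁ ⊆L M₂) × ¬ (M₂ ⊆L M₁)

_ᵗ : IFm → Fm
var n ᵗ    = □ (var n)
⊥ᵢ ᵗ       = ⊥'
(a ∧ᵢ b) ᵗ = (a ᵗ) ∧' (b ᵗ)
(a ∨ᵢ b) ᵗ = (a ᵗ) ∨' (b ᵗ)
(a ⇒ᵢ b) ᵗ = □ ((¬' (a ᵗ)) ∨' (b ᵗ))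
(∀ᵢ a) ᵗ   = □ (∀' (a ᵗ))
(∃ᵢ a) ᵗ   = ∃' (a ᵗ)

data GrzAx : Fm → Set where
  grz : GrzAx (□ (□ (p ⇒ □ p) ⇒ p) ⇒ p)

data LKurAx : Fm → Set where
  lkur : LKurAx (□ (∀' (◇ (□ p))) ⇒ ◇ (∀' p))

data GKurAx : Fm → Set where
  tr : ∀ {a} → Kur a → GKurAx (a ᵗ)

MGrz LKur GKur : Logic
MGrz a = MS4+ GrzAx ⊢ a
LKur a = MS4+ LKurAx ⊢ a
GKur a = MS4+ GKurAx ⊢ a

-- Grz proves McKinsey's axiom □◇p → ◇□p, and McKinsey together with LKur turns the
-- hypothesis □∀□◇□p of the translated Kuroda axiom into □◇□∀□p; since the Gödel translation
-- is sound for extensions of MIPC, GKur ⊆ MGrz ∨ LKur.  Conversely, instantiating the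
-- translated Kuroda axiom at X = □p ∨ □¬□p, for which □◇□X is an S4 theorem, yields ◇□∀□X,
-- and □∀◇□p ∧ ◇□∀□X entails ◇∀p; so LKur ⊆ GKur.  The inclusion is strict: a three-world
-- model validates MS4 and LKur but refutes the translated Kuroda axiom.  Classical
-- tautologies are derived once and for all via Kalmár's lemma from truth-table checks.

module Submission where

open import Defs
open import Data.Bool using (Bool; true; false; _∧_; _∨_; not)
open import Data.Bool.ListAction using (and; all)
open import Data.Bool.Properties using (_≟_)
open import Data.Fin using (Fin; zero; suc)
open import Data.List using (List; []; _∷_; _++_)
open import Data.List.Membership.Propositional using (_∈_)
open import Data.List.Membership.Propositional.Properties using (∈-++⁺ˡ)
open import Data.List.Properties using (map-cong)
open import Data.List.Relation.Unary.Any using (here; there)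
open import Data.Nat using (ℕ; zero; suc; _+_)
open import Data.Product using (_×_; _,_; proj₁; proj₂)
open import Data.Sum using (_⊎_; inj₁; inj₂)
open import Data.Vec using (Vec; []; _∷_; lookup; map)
open import Data.Vec.Properties using (lookup-map)
open import Function using (_∘_)
open import Relation.Nullary using (¬_; Dec)
open import Relation.Nullary.Decidable using (True; toWitness; map′; _×-dec_)
open import Relation.Binary.PropositionalEquality using (_≡_; _≗_; refl; trans; cong; cong₂)
import Relation.Binary.PropositionalEquality as ≡

variable
  k : ℕ
  a b c d : Fm
  Δ : List Fm

-- Propositional schemes and their tautologies

data PFm (k : ℕ) : Set where
  var           : Fin k → PFm k
  ⊥'            : PFm k
  _∧'_ _∨'_ _⇒_ : PFm k → PFm k → PFm k

infixr 6 _∧'_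
infixr 5 _∨'_
infixr 4 _⇒_

¬ₚ_ : PFm k → PFm k
¬ₚ A = A ⇒ ⊥'

v0 : PFm (1 + k)
v0 = var zero
v1 : PFm (2 + k)
v1 = var (suc zero)
v2 : PFm (3 + k)
v2 = var (suc (suc zero))
v3 : PFm (4 + k)
v3 = var (suc (suc (suc zero)))
v4 : PFm (5 + k)
v4 = var (suc (suc (suc (suc zero))))
v5 : PFm (6 + k)
v5 = var (suc (suc (suc (suc (suc zero)))))

_⟦_⟧ᵇ : PFm k → Vec Bool k → Bool
var i    ⟦ ρ ⟧ᵇ = lookup ρ i
⊥'       ⟦ ρ ⟧ᵇ = false
(A ∧' B) ⟦ ρ ⟧ᵇ = A ⟦ ρ ⟧ᵇ ∧ B ⟦ ρ ⟧ᵇ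
(A ∨' B) ⟦ ρ ⟧ᵇ = A ⟦ ρ ⟧ᵇ ∨ B ⟦ ρ ⟧ᵇ
(A ⇒ B)  ⟦ ρ ⟧ᵇ = not (A ⟦ ρ ⟧ᵇ) ∨ B ⟦ ρ ⟧ᵇ

_⟦_⟧ : PFm k → Vec Fm k → Fm
var i    ⟦ xs ⟧ = lookup xs i
⊥'       ⟦ xs ⟧ = ⊥'
(A ∧' B) ⟦ xs ⟧ = A ⟦ xs ⟧ ∧' B ⟦ xs ⟧
(A ∨' B) ⟦ xs ⟧ = A ⟦ xs ⟧ ∨' B ⟦ xs ⟧
(A ⇒ B)  ⟦ xs ⟧ = A ⟦ xs ⟧ ⇒ B ⟦ xs ⟧

Tautology : PFm k → Set
Tautology A = ∀ ρ → A ⟦ ρ ⟧ᵇ ≡ true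

∀-Bool? : {P : Bool → Set} → Dec (P true) → Dec (P false) → Dec (∀ x → P x)
∀-Bool? t? f? = map′ (λ { (t , f) true → t ; (t , f) false → f }) (λ h → h true , h false) (t? ×-dec f?)

∀-Vec? : {P : Vec Bool k → Set} → (∀ ρ → Dec (P ρ)) → Dec (∀ ρ → P ρ)
∀-Vec? {zero}  P? = map′ (λ { p [] → p }) (λ h → h []) (P? [])
∀-Vec? {suc k} P? =
  map′ (λ { h (x ∷ ρ) → h x ρ }) (λ h x ρ → h (x ∷ ρ))
       (∀-Bool? (∀-Vec? (P? ∘ (true ∷_))) (∀-Vec? (P? ∘ (false ∷_))))

tautology? : (A : PFm k) → Dec (Tautology A)
tautology? A = ∀-Vec? (λ ρ → A ⟦ ρ ⟧ᵇ ≟ true)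

-- Derived rules of MS4 + Γ

module Hilbert (Γ : Fm → Set) where

  infix 2 ⊢_ _⊩_

  ⊢_ : Fm → Set
  ⊢ a = MS4+ Γ ⊢ a

  mp₂ : ⊢ a ⇒ b ⇒ c → ⊢ a → ⊢ b → ⊢ c
  mp₂ d e f = mp (mp d e) f

  mp₃ : ⊢ a ⇒ b ⇒ c ⇒ d → ⊢ a → ⊢ b → ⊢ c → ⊢ d
  mp₃ d e f g = mp (mp₂ d e f) g

  ⊢-id : ∀ a → ⊢ a ⇒ a
  ⊢-id a = mp₂ (cpc (ax-S a (a ⇒ a) a)) (cpc (ax-K a (a ⇒ a))) (cpc (ax-K a a))

  data _⊩_ (Δ : List Fm) : Fm → Set where
    hyp : a ∈ Δ → Δ ⊩ a
    thm : ⊢ a → Δ ⊩ a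
    _·_ : Δ ⊩ a ⇒ b → Δ ⊩ a → Δ ⊩ b

  infixl 9 _·_

  deduction : a ∷ Δ ⊩ b → Δ ⊩ a ⇒ b
  deduction (hyp (here refl)) = thm (⊢-id _)
  deduction (hyp (there m))   = thm (cpc (ax-K _ _)) · hyp m
  deduction (thm t)           = thm (mp (cpc (ax-K _ _)) t)
  deduction (d · e)           = thm (cpc (ax-S _ _ _)) · deduction d · deduction e

  weaken : Δ ⊩ b → a ∷ Δ ⊩ b
  weaken (hyp m) = hyp (there m)
  weaken (thm t) = thm t
  weaken (d · e) = weaken d · weaken e

  closed : [] ⊩ a → ⊢ a
  closed (thm t) = t
  closed (d · e) = mp (closed d) (closed e)

  excluded-middle : ∀ a → ⊢ a ∨' ¬' a
  excluded-middle a =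
    closed (thm (cpc (ax-DN _)) · deduction (hyp (here refl) · (thm (cpc (ax-∨I₂ _ _)) · ¬a)))
    where
    ¬a : ¬' (a ∨' ¬' a) ∷ [] ⊩ ¬' a
    ¬a = deduction (hyp (there (here refl)) · (thm (cpc (ax-∨I₁ _ _)) · hyp (here refl)))

  by-cases : a ∷ Δ ⊩ b → ¬' a ∷ Δ ⊩ b → Δ ⊩ b
  by-cases d e = thm (cpc (ax-∨E _ _ _)) · deduction d · deduction e · thm (excluded-middle _)

  literal : Bool → Fm → Fm
  literal true  a = a
  literal false a = ¬' a

  literal-∧ : ∀ x y → Δ ⊩ literal x a → Δ ⊩ literal y b → Δ ⊩ literal (x ∧ y) (a ∧' b)
  literal-∧ true  true  d e = thm (cpc (ax-∧I _ _)) · d · e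
  literal-∧ true  false d e = deduction (weaken e · (thm (cpc (ax-∧E₂ _ _)) · hyp (here refl)))
  literal-∧ false y     d e = deduction (weaken d · (thm (cpc (ax-∧E₁ _ _)) · hyp (here refl)))

  literal-∨ : ∀ x y → Δ ⊩ literal x a → Δ ⊩ literal y b → Δ ⊩ literal (x ∨ y) (a ∨' b)
  literal-∨ true  y     d e = thm (cpc (ax-∨I₁ _ _)) · d
  literal-∨ false true  d e = thm (cpc (ax-∨I₂ _ _)) · e
  literal-∨ false false d e = thm (cpc (ax-∨E _ _ _)) · d · e

  literal-⇒ : ∀ x y → Δ ⊩ literal x a → Δ ⊩ literal y b → Δ ⊩ literal (not x ∨ y) (a ⇒ b)
  literal-⇒ false y     d e = deduction (thm (cpc (ax-⊥E _)) · (weaken d · hyp (here refl)))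
  literal-⇒ true  true  d e = thm (cpc (ax-K _ _)) · e
  literal-⇒ true  false d e = deduction (weaken e · (hyp (here refl) · weaken d))

  kalmar : (A : PFm k) (ρ : Vec Bool k) (xs : Vec Fm k) →
           (∀ i → Δ ⊩ literal (lookup ρ i) (lookup xs i)) → Δ ⊩ literal (A ⟦ ρ ⟧ᵇ) (A ⟦ xs ⟧)
  kalmar (var i)  ρ xs h = h i
  kalmar ⊥'       ρ xs h = thm (⊢-id ⊥')
  kalmar (A ∧' B) ρ xs h = literal-∧ (A ⟦ ρ ⟧ᵇ) (B ⟦ ρ ⟧ᵇ) (kalmar A ρ xs h) (kalmar B ρ xs h)
  kalmar (A ∨' B) ρ xs h = literal-∨ (A ⟦ ρ ⟧ᵇ) (B ⟦ ρ ⟧ᵇ) (kalmar A ρ xs h) (kalmar B ρ xs h)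
  kalmar (A ⇒ B)  ρ xs h = literal-⇒ (A ⟦ ρ ⟧ᵇ) (B ⟦ ρ ⟧ᵇ) (kalmar A ρ xs h) (kalmar B ρ xs h)

  literals : Vec Bool k → Vec Fm k → List Fm
  literals []      []       = []
  literals (x ∷ ρ) (a ∷ xs) = literal x a ∷ literals ρ xs

  literal∈literals : (ρ : Vec Bool k) (xs : Vec Fm k) (i : Fin k) →
                     literal (lookup ρ i) (lookup xs i) ∈ literals ρ xs
  literal∈literals (x ∷ ρ) (a ∷ xs) zero    = here refl
  literal∈literals (x ∷ ρ) (a ∷ xs) (suc i) = there (literal∈literals ρ xs i)

  eliminate-literals : (xs : Vec Fm k) → (∀ ρ → literals ρ xs ++ Δ ⊩ a) → Δ ⊩ a
  eliminate-literals []       h = h []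
  eliminate-literals (x ∷ xs) h = eliminate-literals xs (λ ρ → by-cases (h (true ∷ ρ)) (h (false ∷ ρ)))

  tautology-instance : (A : PFm k) → Tautology A → (xs : Vec Fm k) → ⊢ A ⟦ xs ⟧
  tautology-instance A taut xs = closed (eliminate-literals xs derivable)
    where
    derivable : ∀ ρ → literals ρ xs ++ [] ⊩ A ⟦ xs ⟧
    derivable ρ = ≡.subst (λ x → literals ρ xs ++ [] ⊩ literal x (A ⟦ xs ⟧)) (taut ρ)
                    (kalmar A ρ xs (λ i → hyp (∈-++⁺ˡ (literal∈literals ρ xs i))))

  -- The implicit argument reduces to ⊤ by evaluating the truth table, so call sites supply nothing.
  taut : (A : PFm k) (xs : Vec Fm k) → {True (tautology? A)} → ⊢ A ⟦ xs ⟧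
  taut A xs {ok} = tautology-instance A (toWitness ok) xs

  infixl 5 _⨾_

  _⨾_ : ⊢ a ⇒ b → ⊢ b ⇒ c → ⊢ a ⇒ c
  _⨾_ {a} {b} {c} = mp₂ (taut ((v0 ⇒ v1) ⇒ (v1 ⇒ v2) ⇒ v0 ⇒ v2) (a ∷ b ∷ c ∷ []))

  ⇒-∧ : ⊢ a ⇒ b → ⊢ a ⇒ c → ⊢ a ⇒ b ∧' c
  ⇒-∧ {a} {b} {c} = mp₂ (taut ((v0 ⇒ v1) ⇒ (v0 ⇒ v2) ⇒ v0 ⇒ v1 ∧' v2) (a ∷ b ∷ c ∷ []))

  ⇒-const : ⊢ b → ⊢ a ⇒ b
  ⇒-const = mp (cpc (ax-K _ _))

  contrapose : ⊢ a ⇒ b → ⊢ ¬' b ⇒ ¬' a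
  contrapose {a} {b} = mp (taut ((v0 ⇒ v1) ⇒ ¬ₚ v1 ⇒ ¬ₚ v0) (a ∷ b ∷ []))

  ¬¬-intro : ∀ a → ⊢ a ⇒ ¬' ¬' a
  ¬¬-intro a = taut (v0 ⇒ ¬ₚ ¬ₚ v0) (a ∷ [])

  ¬¬-elim : ∀ a → ⊢ ¬' ¬' a ⇒ a
  ¬¬-elim a = taut (¬ₚ ¬ₚ v0 ⇒ v0) (a ∷ [])

  ⟨_⟩ : Fm → ℕ → Fm
  ⟨ a ⟩ _ = a

  ⟨_∣_⟩ : Fm → Fm → ℕ → Fm
  ⟨ a ∣ b ⟩ zero    = a
  ⟨ a ∣ b ⟩ (suc _) = b

  module Normal (M : Fm → Fm)
                (K : ∀ a b → ⊢ M (a ⇒ b) ⇒ M a ⇒ M b)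
                (T : ∀ a → ⊢ M a ⇒ a)
                (necessitation : ∀ {a} → ⊢ a → ⊢ M a) where

    mono : ⊢ a ⇒ b → ⊢ M a ⇒ M b
    mono d = mp (K _ _) (necessitation d)

    dual-mono : ⊢ a ⇒ b → ⊢ ¬' M (¬' a) ⇒ ¬' M (¬' b)
    dual-mono d = contrapose (mono (contrapose d))

    ∧-distrib : ∀ a b → ⊢ M a ∧' M b ⇒ M (a ∧' b)
    ∧-distrib a b =
      mp (taut ((v0 ⇒ v1 ⇒ v2) ⇒ v0 ∧' v1 ⇒ v2) (M a ∷ M b ∷ M (a ∧' b) ∷ []))
         (mono (taut (v0 ⇒ v1 ⇒ v0 ∧' v1) (a ∷ b ∷ [])) ⨾ K b (a ∧' b))

    ∧-dual : ∀ a b → ⊢ M a ∧' ¬' M (¬' b) ⇒ ¬' M (¬' (a ∧' b))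
    ∧-dual a b =
      mp (taut ((v0 ⇒ v1 ⇒ v2) ⇒ v0 ∧' ¬ₚ v2 ⇒ ¬ₚ v1) (M a ∷ M (¬' (a ∧' b)) ∷ M (¬' b) ∷ []))
         (mono (taut (v0 ⇒ ¬ₚ (v0 ∧' v1) ⇒ ¬ₚ v1) (a ∷ b ∷ [])) ⨾ K (¬' (a ∧' b)) (¬' b))

    dual-intro : ∀ a → ⊢ a ⇒ ¬' M (¬' a)
    dual-intro a = ¬¬-intro a ⨾ contrapose (T (¬' a))

  □-K : ∀ a b → ⊢ □ (a ⇒ b) ⇒ □ a ⇒ □ b
  □-K a b = sub ⟨ a ∣ b ⟩ (ms4 □K)

  □-T : ∀ a → ⊢ □ a ⇒ a
  □-T a = sub ⟨ a ⟩ (ms4 □T)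

  □-4 : ∀ a → ⊢ □ a ⇒ □ (□ a)
  □-4 a = sub ⟨ a ⟩ (ms4 □4)

  ∀-K : ∀ a b → ⊢ ∀' (a ⇒ b) ⇒ ∀' a ⇒ ∀' b
  ∀-K a b = sub ⟨ a ∣ b ⟩ (ms4 ∀K)

  ∀-T : ∀ a → ⊢ ∀' a ⇒ a
  ∀-T a = sub ⟨ a ⟩ (ms4 ∀T)

  ∀-5 : ∀ a → ⊢ ∃' a ⇒ ∀' (∃' a)
  ∀-5 a = sub ⟨ a ⟩ (ms4 ∀5)

  □∀⇒∀□ : ∀ a → ⊢ □ (∀' a) ⇒ ∀' (□ a)
  □∀⇒∀□ a = sub ⟨ a ⟩ (ms4 com)

  open Normal □ □-K □-T nec□ public
    renaming (mono to □-mono; dual-mono to ◇-mono; ∧-distrib to □-∧; ∧-dual to □◇-∧; dual-intro to ◇-intro)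
  open Normal ∀' ∀-K ∀-T nec∀ public
    renaming (mono to ∀-mono; dual-mono to ∃-mono; ∧-distrib to ∀-∧; ∧-dual to ∀∃-∧; dual-intro to ∃-intro)

  ◇◇⇒◇ : ∀ a → ⊢ ◇ (◇ a) ⇒ ◇ a
  ◇◇⇒◇ a = contrapose (□-4 (¬' a) ⨾ □-mono (¬¬-intro _))

  ∃∀⇒∀ : ∀ a → ⊢ ∃' (∀' a) ⇒ ∀' a
  ∃∀⇒∀ a = contrapose (∀-mono (contrapose (∀-mono (¬¬-intro a)))) ⨾ contrapose (∀-5 (¬' a))
          ⨾ ¬¬-elim _ ⨾ ∀-mono (¬¬-elim a)

  ⇒∀∃ : ∀ a → ⊢ a ⇒ ∀' (∃' a)
  ⇒∀∃ a = ∃-intro a ⨾ ∀-5 a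

  ∀-4 : ∀ a → ⊢ ∀' a ⇒ ∀' (∀' a)
  ∀-4 a = ⇒∀∃ (∀' a) ⨾ ∀-mono (∃∀⇒∀ a)

  ∃□⇒□∃ : ∀ a → ⊢ ∃' (□ a) ⇒ □ (∃' a)
  ∃□⇒□∃ a = ∃-mono (□-mono (⇒∀∃ a) ⨾ □∀⇒∀□ (∃' a)) ⨾ ∃∀⇒∀ (□ (∃' a)) ⨾ ∀-T _

  -- Gödel translation

  infixr 4 _⥽_

  _⥽_ : Fm → Fm → Fm
  a ⥽ b = □ (¬' a ∨' b)

  ⥽-intro : ⊢ a ⇒ b → ⊢ a ⥽ b
  ⥽-intro {a} {b} d = nec□ (mp (taut ((v0 ⇒ v1) ⇒ ¬ₚ v0 ∨' v1) (a ∷ b ∷ [])) d)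

  ⥽-elim : ∀ a b → ⊢ (a ⥽ b) ⇒ a ⇒ b
  ⥽-elim a b = □-T _ ⨾ taut (¬ₚ v0 ∨' v1 ⇒ v0 ⇒ v1) (a ∷ b ∷ [])

  ⥽-map : ⊢ a ⇒ b → ⊢ c ⇒ d → ⊢ (b ⥽ c) ⇒ (a ⥽ d)
  ⥽-map {a} {b} {c} {d} f g =
    □-mono (mp₂ (taut ((v0 ⇒ v1) ⇒ (v2 ⇒ v3) ⇒ ¬ₚ v1 ∨' v2 ⇒ ¬ₚ v0 ∨' v3) (a ∷ b ∷ c ∷ d ∷ [])) f g)

  ∧-map : ⊢ a ⇒ b → ⊢ c ⇒ d → ⊢ a ∧' c ⇒ b ∧' d
  ∧-map {a} {b} {c} {d} = mp₂ (taut ((v0 ⇒ v1) ⇒ (v2 ⇒ v3) ⇒ v0 ∧' v2 ⇒ v1 ∧' v3) (a ∷ b ∷ c ∷ d ∷ []))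

  ∨-map : ⊢ a ⇒ b → ⊢ c ⇒ d → ⊢ a ∨' c ⇒ b ∨' d
  ∨-map {a} {b} {c} {d} = mp₂ (taut ((v0 ⇒ v1) ⇒ (v2 ⇒ v3) ⇒ v0 ∨' v2 ⇒ v1 ∨' v3) (a ∷ b ∷ c ∷ d ∷ []))

  Stable : Fm → Set
  Stable a = ⊢ a ⇒ □ a

  stable-□ : Stable a → ⊢ a ⇒ b → ⊢ a ⇒ □ b
  stable-□ s d = s ⨾ □-mono d

  stable-⥽ : Stable a → ⊢ a ∧' b ⇒ c → ⊢ a ⇒ (b ⥽ c)
  stable-⥽ {a} {b} {c} s d = stable-□ s (mp (taut ((v0 ∧' v1 ⇒ v2) ⇒ v0 ⇒ ¬ₚ v1 ∨' v2) (a ∷ b ∷ c ∷ [])) d)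

  stable-∧ : Stable a → Stable b → Stable (a ∧' b)
  stable-∧ {a} {b} s t =
    ⇒-∧ (taut (v0 ∧' v1 ⇒ v0) (a ∷ b ∷ []) ⨾ s) (taut (v0 ∧' v1 ⇒ v1) (a ∷ b ∷ []) ⨾ t) ⨾ □-∧ a b

  stable-∨ : Stable a → Stable b → Stable (a ∨' b)
  stable-∨ {a} {b} s t =
    mp₂ (taut ((v0 ⇒ v2) ⇒ (v1 ⇒ v2) ⇒ v0 ∨' v1 ⇒ v2) (a ∷ b ∷ □ (a ∨' b) ∷ []))
        (stable-□ s (taut (v0 ⇒ v0 ∨' v1) (a ∷ b ∷ [])))
        (stable-□ t (taut (v1 ⇒ v0 ∨' v1) (a ∷ b ∷ [])))

  ᵗ-stable : ∀ φ → Stable (φ ᵗ)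
  ᵗ-stable (var n)  = □-4 _
  ᵗ-stable ⊥ᵢ       = cpc (ax-⊥E _)
  ᵗ-stable (φ ∧ᵢ ψ) = stable-∧ (ᵗ-stable φ) (ᵗ-stable ψ)
  ᵗ-stable (φ ∨ᵢ ψ) = stable-∨ (ᵗ-stable φ) (ᵗ-stable ψ)
  ᵗ-stable (φ ⇒ᵢ ψ) = □-4 _
  ᵗ-stable (∀ᵢ φ)   = □-4 _
  ᵗ-stable (∃ᵢ φ)   = ∃-mono (ᵗ-stable φ) ⨾ ∃□⇒□∃ (φ ᵗ)

  ipc-ᵗ : ∀ {φ} → IPCAx φ → ⊢ φ ᵗ
  ipc-ᵗ (ax-K φ ψ)    = ⥽-intro (stable-□ (ᵗ-stable φ) (taut (v0 ⇒ ¬ₚ v1 ∨' v0) (φ ᵗ ∷ ψ ᵗ ∷ [])))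
  ipc-ᵗ (ax-S φ ψ χ)  =
    ⥽-intro (stable-⥽ (□-4 _) (stable-□ (stable-∧ (□-4 _) (□-4 _))
      (mp₃ (taut ((v0 ⇒ ¬ₚ v1 ∨' v2) ⇒ (v2 ⇒ ¬ₚ v3 ∨' v4) ⇒ (v5 ⇒ ¬ₚ v1 ∨' v3) ⇒ v0 ∧' v5 ⇒ ¬ₚ v1 ∨' v4)
                 ((φ ᵗ ⥽ ψ ᵗ ⥽ χ ᵗ) ∷ φ ᵗ ∷ (ψ ᵗ ⥽ χ ᵗ) ∷ ψ ᵗ ∷ χ ᵗ ∷ (φ ᵗ ⥽ ψ ᵗ) ∷ []))
           (□-T _) (□-T _) (□-T _))))
  ipc-ᵗ (ax-∧I φ ψ)   = ⥽-intro (stable-□ (ᵗ-stable φ) (taut (v0 ⇒ ¬ₚ v1 ∨' v0 ∧' v1) (φ ᵗ ∷ ψ ᵗ ∷ [])))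
  ipc-ᵗ (ax-∧E₁ φ ψ)  = ⥽-intro (taut (v0 ∧' v1 ⇒ v0) (φ ᵗ ∷ ψ ᵗ ∷ []))
  ipc-ᵗ (ax-∧E₂ φ ψ)  = ⥽-intro (taut (v0 ∧' v1 ⇒ v1) (φ ᵗ ∷ ψ ᵗ ∷ []))
  ipc-ᵗ (ax-∨I₁ φ ψ)  = ⥽-intro (taut (v0 ⇒ v0 ∨' v1) (φ ᵗ ∷ ψ ᵗ ∷ []))
  ipc-ᵗ (ax-∨I₂ φ ψ)  = ⥽-intro (taut (v1 ⇒ v0 ∨' v1) (φ ᵗ ∷ ψ ᵗ ∷ []))
  ipc-ᵗ (ax-∨E φ ψ χ) =
    ⥽-intro (stable-⥽ (□-4 _) (stable-□ (stable-∧ (□-4 _) (□-4 _))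
      (mp₂ (taut ((v0 ⇒ ¬ₚ v1 ∨' v2) ⇒ (v3 ⇒ ¬ₚ v4 ∨' v2) ⇒ v0 ∧' v3 ⇒ ¬ₚ (v1 ∨' v4) ∨' v2)
                 ((φ ᵗ ⥽ χ ᵗ) ∷ φ ᵗ ∷ χ ᵗ ∷ (ψ ᵗ ⥽ χ ᵗ) ∷ ψ ᵗ ∷ []))
           (□-T _) (□-T _))))
  ipc-ᵗ (ax-⊥E φ)     = ⥽-intro (cpc (ax-⊥E _))

  mipc-ᵗ : ∀ {φ} → MIPCAx φ → ⊢ φ ᵗ
  mipc-ᵗ a1 = mp₂ (cpc (ax-∧I _ _))
    (⥽-intro (⇒-∧ (□-mono (∀-mono (taut (v0 ∧' v1 ⇒ v0) (□ p ∷ □ q ∷ []))))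
                  (□-mono (∀-mono (taut (v0 ∧' v1 ⇒ v1) (□ p ∷ □ q ∷ []))))))
    (⥽-intro (□-∧ _ _ ⨾ □-mono (∀-∧ (□ p) (□ q))))
  mipc-ᵗ a2 = ⥽-intro (□-T _ ⨾ ∀-T _)
  mipc-ᵗ a3 = ⥽-intro (stable-□ (□-4 _) (□-mono (∀-4 (□ p)) ⨾ □∀⇒∀□ (∀' (□ p))))
  mipc-ᵗ a4 = mp₂ (cpc (ax-∧I _ _))
    (⥽-intro (mp (taut ((v0 ∧' v1 ⇒ v2) ⇒ ¬ₚ v2 ⇒ ¬ₚ v0 ∨' ¬ₚ v1)
                       (∀' (¬' □ p) ∷ ∀' (¬' □ q) ∷ ∀' (¬' (□ p ∨' □ q)) ∷ []))
                 (∀-∧ _ _ ⨾ ∀-mono (taut (¬ₚ v0 ∧' ¬ₚ v1 ⇒ ¬ₚ (v0 ∨' v1)) (□ p ∷ □ q ∷ [])))))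
    (⥽-intro (mp₂ (taut ((v0 ⇒ v2) ⇒ (v1 ⇒ v2) ⇒ v0 ∨' v1 ⇒ v2) (∃' (□ p) ∷ ∃' (□ q) ∷ ∃' (□ p ∨' □ q) ∷ []))
                  (∃-mono (taut (v0 ⇒ v0 ∨' v1) (□ p ∷ □ q ∷ [])))
                  (∃-mono (taut (v1 ⇒ v0 ∨' v1) (□ p ∷ □ q ∷ [])))))
  mipc-ᵗ a5 = ⥽-intro (∃-intro _)
  mipc-ᵗ a6 = ⥽-intro (contrapose (∀-4 _ ⨾ ∀-mono (¬¬-intro _)))
  mipc-ᵗ a7 = ⥽-intro (⇒-∧ (taut (v0 ∧' v1 ⇒ v0) (∃' (□ p) ∷ ∃' (□ q) ∷ []) ⨾ ∀-5 _)
                           (taut (v0 ∧' v1 ⇒ v1) (∃' (□ p) ∷ ∃' (□ q) ∷ []))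
                       ⨾ ∀∃-∧ _ _)
  mipc-ᵗ a8 = ⥽-intro (∃□⇒□∃ _ ⨾ □-mono (∃∀⇒∀ _))
  mipc-ᵗ a9 = ⥽-intro (∃-mono (□-4 _) ⨾ ∃□⇒□∃ _ ⨾ □-mono (∀-5 _))

  ᵗ-isubst : ∀ (σ : ℕ → IFm) φ →
             (⊢ subst (_ᵗ ∘ σ) (φ ᵗ) ⇒ isubst σ φ ᵗ) × (⊢ isubst σ φ ᵗ ⇒ subst (_ᵗ ∘ σ) (φ ᵗ))
  ᵗ-isubst σ (var n)  = □-T _ , ᵗ-stable (σ n)
  ᵗ-isubst σ ⊥ᵢ       = ⊢-id ⊥' , ⊢-id ⊥'
  ᵗ-isubst σ (φ ∧ᵢ ψ) = ∧-map (proj₁ (ᵗ-isubst σ φ)) (proj₁ (ᵗ-isubst σ ψ))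
                      , ∧-map (proj₂ (ᵗ-isubst σ φ)) (proj₂ (ᵗ-isubst σ ψ))
  ᵗ-isubst σ (φ ∨ᵢ ψ) = ∨-map (proj₁ (ᵗ-isubst σ φ)) (proj₁ (ᵗ-isubst σ ψ))
                      , ∨-map (proj₂ (ᵗ-isubst σ φ)) (proj₂ (ᵗ-isubst σ ψ))
  ᵗ-isubst σ (φ ⇒ᵢ ψ) = ⥽-map (proj₂ (ᵗ-isubst σ φ)) (proj₁ (ᵗ-isubst σ ψ))
                      , ⥽-map (proj₁ (ᵗ-isubst σ φ)) (proj₂ (ᵗ-isubst σ ψ))
  ᵗ-isubst σ (∀ᵢ φ)   = □-mono (∀-mono (proj₁ (ᵗ-isubst σ φ))) , □-mono (∀-mono (proj₂ (ᵗ-isubst σ φ)))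
  ᵗ-isubst σ (∃ᵢ φ)   = ∃-mono (proj₁ (ᵗ-isubst σ φ)) , ∃-mono (proj₂ (ᵗ-isubst σ φ))

  ᵗ-sound : ∀ {Λ φ} → (∀ {ψ} → Λ ψ → ⊢ ψ ᵗ) → MIPC+ Λ ⊢ φ → ⊢ φ ᵗ
  ᵗ-sound Λᵗ (ipc x)         = ipc-ᵗ x
  ᵗ-sound Λᵗ (mipc x)        = mipc-ᵗ x
  ᵗ-sound Λᵗ (extra x)       = Λᵗ x
  ᵗ-sound Λᵗ (mp d e)        = mp₂ (⥽-elim _ _) (ᵗ-sound Λᵗ d) (ᵗ-sound Λᵗ e)
  ᵗ-sound Λᵗ (sub {φ} σ d)   = mp (proj₁ (ᵗ-isubst σ φ)) (sub (_ᵗ ∘ σ) (ᵗ-sound Λᵗ d))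
  ᵗ-sound Λᵗ (gen d)         = nec□ (nec∀ (ᵗ-sound Λᵗ d))

-- Kuroda's axiom, Grz and McKinsey

kur-axiom : IFm
kur-axiom = ∀ᵢ (¬ᵢ ¬ᵢ pᵢ) ⇒ᵢ ¬ᵢ ¬ᵢ (∀ᵢ pᵢ)

grz-axiom lkur-axiom : Fm
grz-axiom  = □ (□ (p ⇒ □ p) ⇒ p) ⇒ p
lkur-axiom = □ (∀' (◇ (□ p))) ⇒ ◇ (∀' p)

module Kuroda (Γ : Fm → Set) where
  open Hilbert Γ public

  -- (¬ᵢ ¬ᵢ φ) ᵗ ≡ ¬¬ᵗ (φ ᵗ)
  ¬¬ᵗ : Fm → Fm
  ¬¬ᵗ a = □ (¬' □ (¬' a ∨' ⊥') ∨' ⊥')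

  ¬¬ᵗ⇒□◇ : ∀ a → ⊢ ¬¬ᵗ a ⇒ □ (◇ a)
  ¬¬ᵗ⇒□◇ a = □-mono (mp (taut ((v1 ⇒ v0) ⇒ ¬ₚ v0 ∨' ⊥' ⇒ ¬ₚ v1) (□ (¬' a ∨' ⊥') ∷ □ (¬' a) ∷ []))
                        (□-mono (taut (¬ₚ v0 ⇒ ¬ₚ v0 ∨' ⊥') (a ∷ []))))

  □◇⇒¬¬ᵗ : ∀ a → ⊢ □ (◇ a) ⇒ ¬¬ᵗ a
  □◇⇒¬¬ᵗ a = □-mono (mp (taut ((v0 ⇒ v1) ⇒ ¬ₚ v1 ⇒ ¬ₚ v0 ∨' ⊥') (□ (¬' a ∨' ⊥') ∷ □ (¬' a) ∷ []))
                        (□-mono (taut (¬ₚ v0 ∨' ⊥' ⇒ ¬ₚ v0) (a ∷ []))))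

  ¬◇⊥ : ⊢ ◇ ⊥' ⇒ ⊥'
  ¬◇⊥ = mp (¬¬-intro _) (nec□ (⊢-id ⊥'))

  module _ (⊢grz : ⊢ grz-axiom) (a : Fm) where

    ¬a-persists : Fm
    ¬a-persists = □ (¬' a ⇒ □ (¬' a))

    grz-◇ : ⊢ a ⇒ ◇ (a ∧' ¬a-persists)
    grz-◇ = ¬¬-intro a ⨾ contrapose (sub ⟨ ¬' a ⟩ ⊢grz)
          ⨾ contrapose (□-mono (taut (¬ₚ (v0 ∧' v1) ⇒ v1 ⇒ ¬ₚ v0) (a ∷ ¬a-persists ∷ [])))

    ◇□◇-incompatible : ⊢ (◇ (¬' a) ∧' □ (◇ a)) ∧' (a ∧' ¬a-persists) ⇒ ⊥'
    ◇□◇-incompatible =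
      mp (taut ((v0 ∧' v1 ⇒ ¬ₚ v2) ⇒ (v1 ∧' v2) ∧' (v3 ∧' v0) ⇒ ⊥') (¬a-persists ∷ ◇ (¬' a) ∷ □ (◇ a) ∷ a ∷ []))
         (□◇-∧ _ _ ⨾ ◇-mono (taut ((v0 ⇒ v1) ∧' v0 ⇒ v1) (¬' a ∷ □ (¬' a) ∷ [])))

    grz-□◇-exclusive : ⊢ □ (◇ a) ∧' □ (◇ (¬' a)) ⇒ ⊥'
    grz-□◇-exclusive =
      ⇒-∧ (⇒-∧ (taut (v0 ∧' v1 ⇒ v1) (□ (◇ a) ∷ □ (◇ (¬' a)) ∷ []))
                (taut (v0 ∧' v1 ⇒ v0) (□ (◇ a) ∷ □ (◇ (¬' a)) ∷ []) ⨾ □-4 _) ⨾ □-∧ _ _)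
          (taut (v0 ∧' v1 ⇒ v0) (□ (◇ a) ∷ □ (◇ (¬' a)) ∷ []) ⨾ □-T _ ⨾ ◇-mono grz-◇ ⨾ ◇◇⇒◇ _)
      ⨾ □◇-∧ _ _ ⨾ ◇-mono ◇□◇-incompatible ⨾ ¬◇⊥

    grz⇒mckinsey : ⊢ □ (◇ a) ⇒ ◇ (□ a)
    grz⇒mckinsey =
      mp₂ (taut ((v0 ∧' v1 ⇒ ⊥') ⇒ (v2 ⇒ v1) ⇒ v0 ⇒ ¬ₚ v2) (□ (◇ a) ∷ □ (◇ (¬' a)) ∷ □ (¬' □ a) ∷ []))
          grz-□◇-exclusive (□-mono (contrapose (□-mono (¬¬-elim a))))

  mckinsey+lkur⇒kurᵗ : (∀ a → ⊢ □ (◇ a) ⇒ ◇ (□ a)) → ⊢ lkur-axiom → ⊢ kur-axiom ᵗ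
  mckinsey+lkur⇒kurᵗ mck ⊢lkur =
    ⥽-intro (□-4 _ ⨾ □-mono (¬¬ᵗ-elim ⨾ lkur□) ⨾ □-4 _ ⨾ □-mono (mck _) ⨾ □◇⇒¬¬ᵗ _)
    where
    ¬¬ᵗ-elim : ⊢ □ (∀' (¬¬ᵗ (□ p))) ⇒ □ (∀' (◇ (□ p)))
    ¬¬ᵗ-elim = □-mono (∀-mono (¬¬ᵗ⇒□◇ _ ⨾ □-T _))
    lkur□ : ⊢ □ (∀' (◇ (□ p))) ⇒ ◇ (∀' (□ p))
    lkur□ = □-mono (∀-mono (◇-mono (□-4 p))) ⨾ sub ⟨ □ p ⟩ ⊢lkur

  kurᵗ⇒lkur : ⊢ kur-axiom ᵗ → ⊢ lkur-axiom
  kurᵗ⇒lkur ⊢kur = ⇒-∧ (⊢-id _) (⇒-const ◇□∀□X) ⨾ □◇-∧ _ _ ⨾ ◇-mono collapse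
    where
    X : Fm
    X = □ p ∨' □ (¬' □ p)
    ◇□X : ⊢ ◇ (□ X)
    ◇□X = mp₂ (taut ((v0 ⇒ v1) ⇒ (¬ₚ v0 ⇒ v1) ⇒ v1) (□ (¬' □ p) ∷ ◇ (□ X) ∷ []))
              (□-4 _ ⨾ □-mono (taut (v1 ⇒ v0 ∨' v1) (□ p ∷ □ (¬' □ p) ∷ [])) ⨾ ◇-intro _)
              (◇-mono (□-4 p ⨾ □-mono (taut (v0 ⇒ v0 ∨' v1) (□ p ∷ □ (¬' □ p) ∷ []))))
    ◇□∀□X : ⊢ ◇ (□ (∀' (□ X)))
    ◇□∀□X = mp (¬¬ᵗ⇒□◇ _ ⨾ □-T _)
               (mp₂ (⥽-elim _ _) (sub ⟨ X ⟩ ⊢kur) (nec□ (nec∀ (mp (□◇⇒¬¬ᵗ _) (nec□ ◇□X)))))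
    collapse : ⊢ ∀' (◇ (□ p)) ∧' □ (∀' (□ X)) ⇒ ∀' p
    collapse = ∧-map (⊢-id _) (□-T _) ⨾ ∀-∧ _ _
             ⨾ ∀-mono (∧-map (⊢-id _) (□-T X) ⨾ taut (¬ₚ v1 ∧' (v0 ∨' v1) ⇒ v0) (□ p ∷ □ (¬' □ p) ∷ []) ⨾ □-T p)

-- A three-world model of LKur refuting the translation of Kuroda's axiom

data World : Set where
  w₀ w₁ w₂ : World

-- w₁ sees every world and w₀, w₂ form a cluster above it; the ∀-classes are {w₀} and {w₁, w₂}.
R[_] E[_] : World → List World
R[ w₁ ] = w₀ ∷ w₁ ∷ w₂ ∷ []
R[ _ ]  = w₀ ∷ w₂ ∷ []
E[ w₀ ] = w₀ ∷ []
E[ _ ]  = w₁ ∷ w₂ ∷ []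

box : (World → List World) → (World → Bool) → World → Bool
box succ f w = all f (succ w)

box-cong : ∀ succ {f g : World → Bool} → f ≗ g → box succ f ≗ box succ g
box-cong succ f≗g w = cong and (map-cong f≗g (succ w))

box-true : ∀ succ {f : World → Bool} → (∀ v → f v ≡ true) → ∀ w → box succ f w ≡ true
box-true succ {f} f-true w = all-true (succ w)
  where
  all-true : ∀ vs → all f vs ≡ true
  all-true []       = refl
  all-true (v ∷ vs) rewrite f-true v = all-true vs

Valuation : Set
Valuation = ℕ → World → Bool

⟦_⟧ᴹ : Fm → Valuation → World → Bool
⟦ var n  ⟧ᴹ V w = V n w
⟦ ⊥'     ⟧ᴹ V w = false
⟦ a ∧' b ⟧ᴹ V w = ⟦ a ⟧ᴹ V w ∧ ⟦ b ⟧ᴹ V w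
⟦ a ∨' b ⟧ᴹ V w = ⟦ a ⟧ᴹ V w ∨ ⟦ b ⟧ᴹ V w
⟦ a ⇒ b  ⟧ᴹ V w = not (⟦ a ⟧ᴹ V w) ∨ ⟦ b ⟧ᴹ V w
⟦ □ a    ⟧ᴹ V w = box R[_] (⟦ a ⟧ᴹ V) w
⟦ ∀' a   ⟧ᴹ V w = box E[_] (⟦ a ⟧ᴹ V) w

⟦⟧-cong : ∀ a {V V' : Valuation} → (∀ n → V n ≗ V' n) → ⟦ a ⟧ᴹ V ≗ ⟦ a ⟧ᴹ V'
⟦⟧-cong (var n)  h w = h n w
⟦⟧-cong ⊥'       h w = refl
⟦⟧-cong (a ∧' b) h w = cong₂ _∧_ (⟦⟧-cong a h w) (⟦⟧-cong b h w)
⟦⟧-cong (a ∨' b) h w = cong₂ _∨_ (⟦⟧-cong a h w) (⟦⟧-cong b h w)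
⟦⟧-cong (a ⇒ b)  h w = cong₂ (λ x y → not x ∨ y) (⟦⟧-cong a h w) (⟦⟧-cong b h w)
⟦⟧-cong (□ a)    h w = box-cong R[_] (⟦⟧-cong a h) w
⟦⟧-cong (∀' a)   h w = box-cong E[_] (⟦⟧-cong a h) w

⟦⟧-subst : ∀ σ a V → ⟦ subst σ a ⟧ᴹ V ≗ ⟦ a ⟧ᴹ (λ n → ⟦ σ n ⟧ᴹ V)
⟦⟧-subst σ (var n)  V w = refl
⟦⟧-subst σ ⊥'       V w = refl
⟦⟧-subst σ (a ∧' b) V w = cong₂ _∧_ (⟦⟧-subst σ a V w) (⟦⟧-subst σ b V w)
⟦⟧-subst σ (a ∨' b) V w = cong₂ _∨_ (⟦⟧-subst σ a V w) (⟦⟧-subst σ b V w)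
⟦⟧-subst σ (a ⇒ b)  V w = cong₂ (λ x y → not x ∨ y) (⟦⟧-subst σ a V w) (⟦⟧-subst σ b V w)
⟦⟧-subst σ (□ a)    V w = box-cong R[_] (⟦⟧-subst σ a V) w
⟦⟧-subst σ (∀' a)   V w = box-cong E[_] (⟦⟧-subst σ a V) w

⟦⟧-instance : (A : PFm k) (xs : Vec Fm k) (V : Valuation) (w : World) →
              ⟦ A ⟦ xs ⟧ ⟧ᴹ V w ≡ A ⟦ map (λ a → ⟦ a ⟧ᴹ V w) xs ⟧ᵇ
⟦⟧-instance (var i)  xs V w = ≡.sym (lookup-map i _ xs)
⟦⟧-instance ⊥'       xs V w = refl
⟦⟧-instance (A ∧' B) xs V w = cong₂ _∧_ (⟦⟧-instance A xs V w) (⟦⟧-instance B xs V w)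
⟦⟧-instance (A ∨' B) xs V w = cong₂ _∨_ (⟦⟧-instance A xs V w) (⟦⟧-instance B xs V w)
⟦⟧-instance (A ⇒ B)  xs V w = cong₂ (λ x y → not x ∨ y) (⟦⟧-instance A xs V w) (⟦⟧-instance B xs V w)

Valid : Fm → Set
Valid a = ∀ V w → ⟦ a ⟧ᴹ V w ≡ true

tautology-valid : (A : PFm k) (xs : Vec Fm k) → {True (tautology? A)} → Valid (A ⟦ xs ⟧)
tautology-valid A xs {ok} V w = trans (⟦⟧-instance A xs V w) (toWitness ok _)

cpc-valid : CPCAx a → Valid a
cpc-valid (ax-K a b)   = tautology-valid (v0 ⇒ v1 ⇒ v0) (a ∷ b ∷ [])
cpc-valid (ax-S a b c) = tautology-valid ((v0 ⇒ v1 ⇒ v2) ⇒ (v0 ⇒ v1) ⇒ v0 ⇒ v2) (a ∷ b ∷ c ∷ [])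
cpc-valid (ax-∧I a b)  = tautology-valid (v0 ⇒ v1 ⇒ v0 ∧' v1) (a ∷ b ∷ [])
cpc-valid (ax-∧E₁ a b) = tautology-valid (v0 ∧' v1 ⇒ v0) (a ∷ b ∷ [])
cpc-valid (ax-∧E₂ a b) = tautology-valid (v0 ∧' v1 ⇒ v1) (a ∷ b ∷ [])
cpc-valid (ax-∨I₁ a b) = tautology-valid (v0 ⇒ v0 ∨' v1) (a ∷ b ∷ [])
cpc-valid (ax-∨I₂ a b) = tautology-valid (v1 ⇒ v0 ∨' v1) (a ∷ b ∷ [])
cpc-valid (ax-∨E a b c) = tautology-valid ((v0 ⇒ v2) ⇒ (v1 ⇒ v2) ⇒ v0 ∨' v1 ⇒ v2) (a ∷ b ∷ c ∷ [])
cpc-valid (ax-⊥E a)    = tautology-valid (⊥' ⇒ v0) (a ∷ [])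
cpc-valid (ax-DN a)    = tautology-valid (¬ₚ ¬ₚ v0 ⇒ v0) (a ∷ [])

∀-World? : {P : World → Set} → (∀ w → Dec (P w)) → Dec (∀ w → P w)
∀-World? P? = map′ (λ { (p₀ , p₁ , p₂) w₀ → p₀ ; (p₀ , p₁ , p₂) w₁ → p₁ ; (p₀ , p₁ , p₂) w₂ → p₂ })
                   (λ h → h w₀ , h w₁ , h w₂)
                   (P? w₀ ×-dec P? w₁ ×-dec P? w₂)

proposition : Vec Bool 3 → World → Bool
proposition (x₀ ∷ x₁ ∷ x₂ ∷ []) w₀ = x₀
proposition (x₀ ∷ x₁ ∷ x₂ ∷ []) w₁ = x₁
proposition (x₀ ∷ x₁ ∷ x₂ ∷ []) w₂ = x₂

truth-table : (World → Bool) → Vec Bool 3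
truth-table x = x w₀ ∷ x w₁ ∷ x w₂ ∷ []

proposition-truth-table : ∀ x → x ≗ proposition (truth-table x)
proposition-truth-table x w₀ = refl
proposition-truth-table x w₁ = refl
proposition-truth-table x w₂ = refl

p,q↦ : (World → Bool) → (World → Bool) → Valuation
p,q↦ x y zero    = x
p,q↦ x y (suc _) = y

Valid-in-p,q : Fm → Set
Valid-in-p,q a = ∀ xs ys w → ⟦ a ⟧ᴹ (p,q↦ (proposition xs) (proposition ys)) w ≡ true

valid-in-p,q? : ∀ a → Dec (Valid-in-p,q a)
valid-in-p,q? a = ∀-Vec? λ xs → ∀-Vec? λ ys → ∀-World? λ w → _ ≟ true

p,q-valid : ∀ a → {True (valid-in-p,q? a)} → ∀ x y → ⟦ a ⟧ᴹ (p,q↦ x y) ≗ λ _ → true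
p,q-valid a {ok} x y w =
  trans (⟦⟧-cong a tabulated w) (toWitness ok (truth-table x) (truth-table y) w)
  where
  tabulated : ∀ n → p,q↦ x y n ≗ p,q↦ (proposition (truth-table x)) (proposition (truth-table y)) n
  tabulated zero    = proposition-truth-table x
  tabulated (suc _) = proposition-truth-table y

-- For a formula in p and q, ⟦ a ⟧ᴹ V is definitionally ⟦ a ⟧ᴹ (p,q↦ (V 0) (V 1)).
ms4-valid : MS4Ax a → Valid a
ms4-valid {a} □K  V = p,q-valid a (V 0) (V 1)
ms4-valid {a} □T  V = p,q-valid a (V 0) (V 1)
ms4-valid {a} □4  V = p,q-valid a (V 0) (V 1)
ms4-valid {a} ∀K  V = p,q-valid a (V 0) (V 1)
ms4-valid {a} ∀T  V = p,q-valid a (V 0) (V 1)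
ms4-valid {a} ∀5  V = p,q-valid a (V 0) (V 1)
ms4-valid {a} com V = p,q-valid a (V 0) (V 1)

lkur-valid : LKurAx a → Valid a
lkur-valid {a} lkur V = p,q-valid a (V 0) (V 1)

sound : ∀ {Γ} → (∀ {b} → Γ b → Valid b) → MS4+ Γ ⊢ a → Valid a
sound Γ-valid (cpc x)       = cpc-valid x
sound Γ-valid (ms4 x)       = ms4-valid x
sound Γ-valid (extra x)     = Γ-valid x
sound Γ-valid (mp d e) V w  = modus-ponens (sound Γ-valid d V w) (sound Γ-valid e V w)
  where
  modus-ponens : ∀ {x y} → not x ∨ y ≡ true → x ≡ true → y ≡ true
  modus-ponens x⇒y refl = x⇒y
sound Γ-valid (sub {a} σ d) V w = trans (⟦⟧-subst σ a V w) (sound Γ-valid d _ w)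
sound Γ-valid (nec□ d) V    = box-true R[_] (sound Γ-valid d V)
sound Γ-valid (nec∀ d) V    = box-true E[_] (sound Γ-valid d V)

p-off-w₁ : Valuation
p-off-w₁ _ w₁ = false
p-off-w₁ _ _  = true

kurᵗ-refuted : ⟦ kur-axiom ᵗ ⟧ᴹ p-off-w₁ w₀ ≡ false
kurᵗ-refuted = refl

extend-axioms : ∀ {Γ Δ} → (∀ {b} → Γ b → MS4+ Δ ⊢ b) → MS4+ Γ ⊢ a → MS4+ Δ ⊢ a
extend-axioms h (cpc x)   = cpc x
extend-axioms h (ms4 x)   = ms4 x
extend-axioms h (extra x) = h x
extend-axioms h (mp d e)  = mp (extend-axioms h d) (extend-axioms h e)
extend-axioms h (sub σ d) = sub σ (extend-axioms h d)
extend-axioms h (nec□ d)  = nec□ (extend-axioms h d)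
extend-axioms h (nec∀ d)  = nec∀ (extend-axioms h d)

∨L-inj₁ : ∀ {M N} → M ⊆L (M ∨L N)
∨L-inj₁ _ m = extra (inj₁ m)

∨L-inj₂ : ∀ {M N} → N ⊆L (M ∨L N)
∨L-inj₂ _ n = extra (inj₂ n)

∨L-least : ∀ {M N Γ} → M ⊆L (MS4+ Γ ⊢_) → N ⊆L (MS4+ Γ ⊢_) → (M ∨L N) ⊆L (MS4+ Γ ⊢_)
∨L-least M⊆ N⊆ _ = extend-axioms λ { (inj₁ m) → M⊆ _ m ; (inj₂ n) → N⊆ _ n }

GKur⊢kurᵗ : GKur (kur-axiom ᵗ)
GKur⊢kurᵗ = extra (tr (extra kur))

LKur⊆GKur : LKur ⊆L GKur
LKur⊆GKur _ = extend-axioms λ { lkur → Kuroda.kurᵗ⇒lkur GKurAx GKur⊢kurᵗ }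

GKur⊈LKur : ¬ (GKur ⊆L LKur)
GKur⊈LKur GKur⊆LKur
  with () ← trans (≡.sym kurᵗ-refuted) (sound lkur-valid (GKur⊆LKur _ GKur⊢kurᵗ) p-off-w₁ w₀)

GKur⊆MGrz∨LKur : GKur ⊆L (MGrz ∨L LKur)
GKur⊆MGrz∨LKur _ = extend-axioms λ { (tr d) → ᵗ-sound (λ { kur → kurᵗ }) d }
  where
  open Kuroda (λ b → MGrz b ⊎ LKur b)
  kurᵗ : ⊢ kur-axiom ᵗ
  kurᵗ = mckinsey+lkur⇒kurᵗ (grz⇒mckinsey (∨L-inj₁ _ (extra grz))) (∨L-inj₂ _ (extra lkur))

proposition4p14 : (LKur ⊊L GKur) × ((MGrz ∨L LKur) ≐L (MGrz ∨L GKur))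
proposition4p14 =
  (LKur⊆GKur , GKur⊈LKur) ,
  (∨L-least ∨L-inj₁ (λ a d → ∨L-inj₂ a (LKur⊆GKur a d)) , ∨L-least ∨L-inj₁ GKur⊆MGrz∨LKur)
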